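{- Fix a positive integer $k$ and let $q=p^{\ell}$ be an odd prime power with $p\ge k$ prime. There is a constant $C$ depending only on $k$ and $q$ such that for every $n\ge1$, if $A\subseteq\mathbb{F}_q^n$ contains no pairwise distinct vectors $\vec{x}_1,\ldots,\vec{x}_k$ with $\langle \vec{x}_i-\vec{x}_j,\vec{x}_j-\vec{x}_\ell\rangle=0$ for all pairwise distinct $i,j,\ell\in\{1,\ldots,k\}$, then $|A|\le C n^{(k+1)(q-1)}$.
   Context: $\langle \vec{u},\vec{v}\rangle=\sum_{s=1}^n u_s v_s$ is the standard bilinear form on $\mathbb{F}_q^n$. -}

module Defs where

open import Level using (0ℓ)
open import Data.Nat using (ℕ)
open import Data.Fin using (Fin)
open import Data.Vec using (Vec; zipWith; foldr)
open import Data.Product using (Σ)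
open import Relation.Binary.PropositionalEquality using (_≡_)
open import Relation.Nullary using (¬_)
open import Algebra.Structures using (IsCommutativeRing)
open import Function.Bundles using (_↔_)

record FiniteField (q : ℕ) : Set₁ where
  field
    Carrier : Set
    _+_ _*_ : Carrier → Carrier → Carrier
    -_      : Carrier → Carrier
    0# 1#   : Carrier
    isCommutativeRing : IsCommutativeRing _≡_ _+_ _*_ -_ 0# 1#
    0≢1     : ¬ (0# ≡ 1#)
    inverse : (x : Carrier) → ¬ (x ≡ 0#) → Σ Carrier (λ y → x * y ≡ 1#)
    card    : Carrier ↔ Fin q

  infixl 6 _+_
  infixl 7 _*_
  infix  8 -_

  _⊖_ : ∀ {n} → Vec Carrier n → Vec Carrier n → Vec Carrier n
  u ⊖ v = zipWith (λ a b → a + (- b)) u v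

  ⟨_,_⟩ : ∀ {n} → Vec Carrier n → Vec Carrier n → Carrier
  ⟨ u , v ⟩ = foldr _ _+_ 0# (zipWith _*_ u v)

{-# OPTIONS --safe #-}
module Submission where

-- Call a, b ∈ 𝔽_q^n isotropic when Q(a − b) = ⟨a − b, a − b⟩ = 0. Since
-- Q(a − c) = Q(a − b) + 2⟨a − b, b − c⟩ + Q(b − c) and 2 ≠ 0 (in characteristic 2 the map
-- x ↦ x + 1 would pair off the elements of 𝔽_q, making q even), k pairwise isotropic points
-- of A form a forbidden configuration: the isotropy graph on A has no k-clique. Its
-- independent sets are small by the polynomial method: with δ(x) = ∏_{c ≠ 0} (x − c), the
-- functions b ↦ δ(Q(aᵢ − b)) attached to pairwise non-isotropic a₁, …, a_m vanish at aⱼ for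
-- j ≠ i but not at aᵢ, and each is an inner product of a vector of dimension (n + 2)^(q−1)
-- with one depending only on b; such a biorthogonal system has at most that many members.
-- Ramsey's theorem then bounds |A| by R(k, (n + 2)^(q−1) + 1) ≤ (k + 1 + (n + 2)^(q−1))^k.

open import Defs
open import Level using (0ℓ)
open import Data.Nat as ℕ using (ℕ; zero; suc; _≤_; _<_; z≤n; s≤s)
open import Data.Nat.Properties using (n≮0; +-suc; +-mono-≤; ≤-pred; ≤-trans; suc-injective; m≤n⇒m≤1+n; _≤?_; ≰⇒>)
open import Data.Nat.Divisibility using (_∣_; _∣0; ∣m∣n⇒∣m+n; ∣-refl; ∣1⇒≡1)
open import Data.Nat.Primality using (Prime; euclidsLemma; prime[2]; prime⇒irreducible; prime⇒nonTrivial)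
open import Data.Fin using (Fin; zero; suc; punchIn; punchOut; inject≤)
open import Data.Fin.Properties
  using (all?; ¬∀⟶∃¬; punchInᵢ≢i; punchIn-injective; punchIn-punchOut; inject≤-injective)
import Data.Fin.Properties as Fin
open import Data.Vec using (Vec; []; _∷_; _++_; map; zipWith; head; tail)
open import Data.List using (List; []; _∷_; length; lookup; filter; tabulate)
open import Data.List.Properties using (filter-accept; filter-reject; filter-all; length-tabulate)
open import Data.List.Relation.Unary.All as All using (All)
open import Data.List.Relation.Unary.Any using (here; there)
open import Data.List.Relation.Unary.AllPairs using (AllPairs; []; _∷_)
open import Data.List.Relation.Unary.Unique.Propositional using (Unique)
import Data.List.Relation.Unary.Unique.Propositional.Properties as Unique
open import Data.List.Membership.Propositional using (_∈_)
open import Data.List.Membership.Propositional.Properties using (∈-lookup; ∈-filter⁻; ∈-filter⁺; ∈-tabulate⁺)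
open import Data.List.Relation.Binary.Subset.Propositional using (_⊆_)
open import Data.List.Relation.Binary.Subset.Propositional.Properties using (filter-⊆; ∷⁺ʳ; ⊆-trans; xs⊆x∷xs)
open import Data.Product using (Σ; ∃; _×_; _,_; proj₁; proj₂)
open import Data.Sum using ([_,_]′; inj₁; inj₂)
open import Data.Empty using (⊥-elim)
open import Function using (_∘_; _∘′_; id)
open import Function.Bundles using (Inverse; Injection)
open import Function.Definitions using (Injective)
open import Function.Properties.Inverse using (↔⇒↣; ↔-sym)
open import Relation.Binary.PropositionalEquality
open import Relation.Binary.Definitions using (Symmetric; DecidableEquality)
open import Relation.Nullary using (¬_; Dec; yes; no; ¬?; contradiction)
open import Relation.Nullary.Decidable using (via-injection; decidable-stable)
open import Relation.Unary using (Pred; Decidable)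
open import Relation.Unary.Properties using (∁?)
open import Algebra.Bundles using (CommutativeRing)
import Algebra.Properties.Ring as RingProperties
import Algebra.Properties.CommutativeSemigroup as CommutativeSemigroupProperties
import Algebra.Properties.Monoid.Sum as MonoidSum
import Algebra.Solver.Ring.NaturalCoefficients.Default as SemiringSolver

lookup-AllPairs : ∀ {A : Set} {R : A → A → Set} → Symmetric R → ∀ {xs} → AllPairs R xs →
                  ∀ {i j} → i ≢ j → R (lookup xs i) (lookup xs j)
lookup-AllPairs sym (_  ∷ _)   {zero}  {zero}  i≢j = ⊥-elim (i≢j refl)
lookup-AllPairs sym (Rx ∷ _)   {zero}  {suc j} _   = All.lookup Rx (∈-lookup j)
lookup-AllPairs sym (Rx ∷ _)   {suc i} {zero}  _   = sym (All.lookup Rx (∈-lookup i))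
lookup-AllPairs sym (_  ∷ Rxs) {suc i} {suc j} i≢j = lookup-AllPairs sym Rxs (i≢j ∘ cong suc)

module _ {A : Set} {P : Pred A 0ℓ} (P? : Decidable P) where

  length-filter-split : ∀ xs → length xs ≡ length (filter P? xs) ℕ.+ length (filter (∁? P?) xs)
  length-filter-split []       = refl
  length-filter-split (x ∷ xs) with P? x
  ... | yes _ = cong suc (length-filter-split xs)
  ... | no  _ = trans (cong suc (length-filter-split xs)) (sym (+-suc _ _))

module _ {A : Set} (_≟_ : DecidableEquality A) where

  length-filter-≢ : ∀ {x xs} → Unique xs → x ∈ xs → suc (length (filter (λ y → ¬? (y ≟ x)) xs)) ≡ length xs
  length-filter-≢ {x} (y∉xs ∷ _) (here refl) =
    cong (suc ∘′ length) (trans (filter-reject (λ z → ¬? (z ≟ x)) (λ y≢y → y≢y refl))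
                                (filter-all (λ z → ¬? (z ≟ x)) (All.map (λ y≢z z≡y → y≢z (sym z≡y)) y∉xs)))
  length-filter-≢ {x} (y∉xs ∷ unique) (there x∈xs) =
    trans (cong (suc ∘′ length) (filter-accept (λ z → ¬? (z ≟ x)) (λ y≡x → All.lookup y∉xs x∈xs y≡x)))
          (cong suc (length-filter-≢ unique x∈xs))

  module _ (σ : A → A) (σ-involutive : ∀ x → σ (σ x) ≡ x) (σ-fixedPointFree : ∀ x → σ x ≢ x) where

    σ-injective : ∀ {x y} → σ x ≡ σ y → x ≡ y
    σ-injective {x} {y} σx≡σy = trans (sym (σ-involutive x)) (trans (cong σ σx≡σy) (σ-involutive y))

    -- Indexed by n = length xs, so that removing the pair {a, σ a} is structural recursion.
    σ-closed-length-even : ∀ n (xs : List A) → length xs ≡ n → Unique xs →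
                           (∀ {x} → x ∈ xs → σ x ∈ xs) → 2 ∣ n
    σ-closed-length-even zero          []       _ _ _ = 2 ∣0
    σ-closed-length-even (suc zero)    (a ∷ []) _ _ closed with closed (here refl)
    ... | here σa≡a = ⊥-elim (σ-fixedPointFree a σa≡a)
    σ-closed-length-even (suc (suc n)) (a ∷ xs) |xs|≡ (a∉xs ∷ unique) closed =
      ∣m∣n⇒∣m+n ∣-refl (σ-closed-length-even n ys |ys|≡n (Unique.filter⁺ _ unique) ys-closed)
      where
      σa∈xs : σ a ∈ xs
      σa∈xs with closed (here refl)
      ... | here σa≡a   = ⊥-elim (σ-fixedPointFree a σa≡a)
      ... | there σa∈xs = σa∈xs
      ys : List A
      ys = filter (λ y → ¬? (y ≟ σ a)) xs
      |ys|≡n : length ys ≡ n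
      |ys|≡n = suc-injective (trans (length-filter-≢ unique σa∈xs) (suc-injective |xs|≡))
      ys-closed : ∀ {x} → x ∈ ys → σ x ∈ ys
      ys-closed {x} x∈ys with ∈-filter⁻ (λ y → ¬? (y ≟ σ a)) {xs = xs} x∈ys
      ... | x∈xs , x≢σa with closed (there x∈xs)
      ... | here σx≡a   = ⊥-elim (x≢σa (σ-injective (trans σx≡a (sym (σ-involutive a)))))
      ... | there σx∈xs = ∈-filter⁺ (λ y → ¬? (y ≟ σ a)) σx∈xs
                            (λ σx≡σa → All.lookup a∉xs x∈xs (sym (σ-injective σx≡σa)))

prime∣^⇒prime∣ : ∀ {r m} n → Prime r → r ∣ m ℕ.^ n → r ∣ m
prime∣^⇒prime∣ zero r-prime r∣1 =
  contradiction (∣1⇒≡1 r∣1) (ℕ.nonTrivial⇒≢1 {{prime⇒nonTrivial r-prime}})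
prime∣^⇒prime∣ {m = m} (suc n) r-prime r∣m*m^n =
  [ id , prime∣^⇒prime∣ n r-prime ]′ (euclidsLemma m (m ℕ.^ n) r-prime r∣m*m^n)

odd-prime⇒2∤p^ℓ : ∀ {p} ℓ → Prime p → p ≢ 2 → ¬ 2 ∣ p ℕ.^ ℓ
odd-prime⇒2∤p^ℓ ℓ p-prime p≢2 2∣p^ℓ with prime⇒irreducible p-prime (prime∣^⇒prime∣ ℓ prime[2] 2∣p^ℓ)
... | inj₁ ()
... | inj₂ 2≡p = p≢2 (sym 2≡p)

-- Ramsey's theorem

-- The Erdős–Szekeres recursion for an upper bound on the Ramsey number R(s, t).
ramseyBound : ℕ → ℕ → ℕ
ramseyBound zero    _       = 0
ramseyBound (suc s) zero    = 0
ramseyBound (suc s) (suc t) = suc (ramseyBound s (suc t) ℕ.+ ramseyBound (suc s) t)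

module _ {V : Set} {R : V → V → Set} (R? : ∀ x y → Dec (R x y)) where

  ramsey : ∀ s t (A : List V) → Unique A →
           (∀ {X} → X ⊆ A → Unique X → AllPairs R X → length X < s) →
           (∀ {X} → X ⊆ A → AllPairs (λ x y → ¬ R x y) X → length X < t) →
           length A ≤ ramseyBound s t
  ramsey _       _       []       _ _      _     = z≤n
  ramsey zero    _       (a ∷ A) _ clique _     = ⊥-elim (n≮0 (clique (λ ()) [] []))
  ramsey (suc s) zero    (a ∷ A) _ _      indep = ⊥-elim (n≮0 (indep (λ ()) []))
  ramsey (suc s) (suc t) (a ∷ A) (a∉A ∷ uniqueA) clique indep
    rewrite length-filter-split (R? a) A =
    s≤s (+-mono-≤ (ramsey s (suc t) N (Unique.filter⁺ (R? a) uniqueA) cliqueN indepN)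
                  (ramsey (suc s) t M (Unique.filter⁺ (∁? (R? a)) uniqueA) cliqueM indepM))
    where
    N M : List V
    N = filter (R? a) A
    M = filter (∁? (R? a)) A
    a∉ : ∀ {X} → X ⊆ A → All (a ≢_) X
    a∉ X⊆A = All.tabulate (All.lookup a∉A ∘ X⊆A)
    related : ∀ {P : Pred V 0ℓ} (P? : Decidable P) {X} → X ⊆ filter P? A → All P X
    related P? X⊆ = All.tabulate (proj₂ ∘ ∈-filter⁻ P? {xs = A} ∘ X⊆)
    ⊆a∷A : ∀ {P : Pred V 0ℓ} (P? : Decidable P) {X} → X ⊆ filter P? A → X ⊆ a ∷ A
    ⊆a∷A P? X⊆ = ⊆-trans X⊆ (⊆-trans (filter-⊆ P? A) (xs⊆x∷xs A a))
    a∷⊆a∷A : ∀ {P : Pred V 0ℓ} (P? : Decidable P) {X} → X ⊆ filter P? A → a ∷ X ⊆ a ∷ A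
    a∷⊆a∷A P? X⊆ = ∷⁺ʳ a (⊆-trans X⊆ (filter-⊆ P? A))
    cliqueN : ∀ {X} → X ⊆ N → Unique X → AllPairs R X → length X < s
    cliqueN X⊆N uniqueX cliqueX = ≤-pred (clique (a∷⊆a∷A (R? a) X⊆N)
      (a∉ (⊆-trans X⊆N (filter-⊆ (R? a) A)) ∷ uniqueX) (related (R? a) X⊆N ∷ cliqueX))
    cliqueM : ∀ {X} → X ⊆ M → Unique X → AllPairs R X → length X < suc s
    cliqueM = clique ∘ ⊆a∷A (∁? (R? a))
    indepN : ∀ {X} → X ⊆ N → AllPairs (λ x y → ¬ R x y) X → length X < suc t
    indepN = indep ∘ ⊆a∷A (R? a)
    indepM : ∀ {X} → X ⊆ M → AllPairs (λ x y → ¬ R x y) X → length X < t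
    indepM X⊆M indepX = ≤-pred (indep (a∷⊆a∷A (∁? (R? a)) X⊆M) (related (∁? (R? a)) X⊆M ∷ indepX))

module RamseyBoundArithmetic where

  open import Data.Nat using (_+_; _*_; _^_)
  open import Data.Nat.Properties
  open import Data.Nat.Tactic.RingSolver using (solve-∀)

  ^-distrib-* : ∀ m n o → (m * n) ^ o ≡ m ^ o * n ^ o
  ^-distrib-* m n zero    = refl
  ^-distrib-* m n (suc o) = begin
    m * n * (m * n) ^ o       ≡⟨ cong (m * n *_) (^-distrib-* m n o) ⟩
    m * n * (m ^ o * n ^ o)   ≡⟨ interchange m n (m ^ o) (n ^ o) ⟩
    m * m ^ o * (n * n ^ o)   ∎
    where
    open ≡-Reasoning
    interchange : ∀ a b c d → a * b * (c * d) ≡ a * c * (b * d)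
    interchange = solve-∀

  1+m^[1+n]+m^[2+n]≤[1+m]^[2+n] : ∀ m n → suc (m ^ suc n + m ^ suc (suc n)) ≤ suc m ^ suc (suc n)
  1+m^[1+n]+m^[2+n]≤[1+m]^[2+n] m n =
    +-mono-≤ (^-monoˡ-< (suc n) (n<1+n m)) (*-monoʳ-≤ m (^-monoˡ-≤ (suc n) (n≤1+n m)))

  ramseyBound≤ : ∀ s t → ramseyBound s t ≤ (s + t) ^ s
  ramseyBound≤ zero          _       = z≤n
  ramseyBound≤ (suc s)       zero    = z≤n
  ramseyBound≤ 1             (suc t) = s≤s (ramseyBound≤ 1 t)
  ramseyBound≤ (suc (suc s)) (suc t) = begin
    suc (ramseyBound (suc s) (suc t) + ramseyBound (suc (suc s)) t)
      ≤⟨ s≤s (+-mono-≤ (ramseyBound≤ (suc s) (suc t)) (ramseyBound≤ (suc (suc s)) t)) ⟩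
    suc ((suc s + suc t) ^ suc s + (suc (suc s) + t) ^ suc (suc s))
      ≡⟨ cong (λ u → suc ((suc s + suc t) ^ suc s + suc u ^ suc (suc s))) (sym (+-suc s t)) ⟩
    suc ((suc s + suc t) ^ suc s + (suc s + suc t) ^ suc (suc s))
      ≤⟨ 1+m^[1+n]+m^[2+n]≤[1+m]^[2+n] (suc s + suc t) s ⟩
    (suc (suc s) + suc t) ^ suc (suc s) ∎
    where open ≤-Reasoning

  2+n≤3*n : ∀ {n} → 1 ≤ n → 2 + n ≤ 3 * n
  2+n≤3*n {n} 1≤n = begin
    2 + n     ≡⟨ +-comm 2 n ⟩
    n + 2     ≤⟨ +-monoʳ-≤ n (*-monoʳ-≤ 2 1≤n) ⟩
    n + 2 * n ≡⟨⟩
    3 * n     ∎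
    where open ≤-Reasoning

  ramseyBound-poly : ∀ k m n → 1 ≤ n →
    ramseyBound k (suc ((2 + n) ^ m)) ≤ (k + 1 + 3 ^ m) ^ k * n ^ ((k + 1) * m)
  ramseyBound-poly k m n@(suc _) 1≤n = begin
    ramseyBound k (suc ((2 + n) ^ m))   ≤⟨ ramseyBound≤ k _ ⟩
    (k + suc ((2 + n) ^ m)) ^ k          ≤⟨ ^-monoˡ-≤ k base ⟩
    (C * n ^ m) ^ k                      ≡⟨ ^-distrib-* C (n ^ m) k ⟩
    C ^ k * (n ^ m) ^ k                  ≡⟨ cong (C ^ k *_) (^-*-assoc n m k) ⟩
    C ^ k * n ^ (m * k)                  ≤⟨ *-monoʳ-≤ (C ^ k) (^-monoʳ-≤ n m*k≤[k+1]*m) ⟩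
    C ^ k * n ^ ((k + 1) * m)            ∎
    where
    open ≤-Reasoning
    C = k + 1 + 3 ^ m
    m*k≤[k+1]*m : m * k ≤ (k + 1) * m
    m*k≤[k+1]*m = begin
      m * k      ≡⟨ *-comm m k ⟩
      k * m      ≤⟨ m≤m+n (k * m) m ⟩
      k * m + m  ≡⟨ cong (k * m +_) (sym (*-identityˡ m)) ⟩
      k * m + 1 * m ≡⟨ sym (*-distribʳ-+ m k 1) ⟩
      (k + 1) * m ∎
    base : k + suc ((2 + n) ^ m) ≤ C * n ^ m
    base = begin
      k + suc ((2 + n) ^ m)           ≡⟨ sym (+-assoc k 1 _) ⟩
      k + 1 + (2 + n) ^ m             ≤⟨ +-mono-≤ (m≤m*n (k + 1) (n ^ m) {{m^n≢0 n m}}) (^-monoˡ-≤ m (2+n≤3*n 1≤n)) ⟩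
      (k + 1) * n ^ m + (3 * n) ^ m   ≡⟨ cong ((k + 1) * n ^ m +_) (^-distrib-* 3 n m) ⟩
      (k + 1) * n ^ m + 3 ^ m * n ^ m ≡⟨ sym (*-distribʳ-+ (n ^ m) (k + 1) (3 ^ m)) ⟩
      C * n ^ m                       ∎

open RamseyBoundArithmetic using (ramseyBound-poly)

module _ {q : ℕ} (F : FiniteField q) where

  open FiniteField F using (Carrier; isCommutativeRing; 0≢1; inverse; card; _⊖_; ⟨_,_⟩)

  commutativeRing : CommutativeRing 0ℓ 0ℓ
  commutativeRing = record { isCommutativeRing = isCommutativeRing }

  open CommutativeRing commutativeRing
    using (_+_; _*_; -_; _-_; 0#; 1#; +-identityˡ; +-identityʳ; +-assoc; -‿inverseˡ; -‿inverseʳ;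
           *-identityˡ; *-identityʳ; *-assoc; *-comm; zeroˡ; zeroʳ; distribˡ; distribʳ;
           *-monoid; +-commutativeSemigroup; commutativeSemiring; ring)
  open RingProperties ring
    using (-‿distribˡ-*; -‿distribʳ-*; -‿involutive; -‿+-comm; -0#≈0#; +-cancelˡ; ⁻¹-anti-homo‿-; [y-z]x≈yx-zx)
  open CommutativeSemigroupProperties +-commutativeSemigroup using (interchange)
  open MonoidSum *-monoid using (sum-cong-≗) renaming (sum to ∏)
  open SemiringSolver commutativeSemiring using (solve; _:+_; _:*_; _:=_; con)
  open ≡-Reasoning

  _≟_ : DecidableEquality Carrier
  _≟_ = via-injection (↔⇒↣ card) Fin._≟_

  1+1≡0⇒2∣q : 1# + 1# ≡ 0# → 2 ∣ q
  1+1≡0⇒2∣q 1+1≡0 = subst (2 ∣_) (length-tabulate from)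
    (σ-closed-length-even _≟_ (_+ 1#) +1+1≡id +1≢id _ elements refl
      (Unique.tabulate⁺ (Injection.injective (↔⇒↣ (↔-sym card)))) (λ _ → ∈-elements))
    where
    open Inverse card using (to; from; strictlyInverseʳ)
    elements : List Carrier
    elements = tabulate from
    ∈-elements : ∀ {x} → x ∈ elements
    ∈-elements {x} = subst (_∈ elements) (strictlyInverseʳ x) (∈-tabulate⁺ (to x))
    +1+1≡id : ∀ x → x + 1# + 1# ≡ x
    +1+1≡id x = trans (+-assoc x 1# 1#) (trans (cong (x +_) 1+1≡0) (+-identityʳ x))
    +1≢id : ∀ x → x + 1# ≢ x
    +1≢id x x+1≡x = 0≢1 (sym (+-cancelˡ x 1# 0# (trans x+1≡x (sym (+-identityʳ x)))))

  x≢0∧x*y≡0⇒y≡0 : ∀ {x y} → x ≢ 0# → x * y ≡ 0# → y ≡ 0#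
  x≢0∧x*y≡0⇒y≡0 {x} {y} x≢0 x*y≡0 with inverse x x≢0
  ... | x⁻¹ , x*x⁻¹≡1 = begin
    y                 ≡⟨ sym (*-identityˡ y) ⟩
    1# * y            ≡⟨ cong (_* y) (sym x*x⁻¹≡1) ⟩
    x * x⁻¹ * y       ≡⟨ solve 3 (λ a b c → a :* b :* c := b :* (a :* c)) refl x x⁻¹ y ⟩
    x⁻¹ * (x * y)     ≡⟨ cong (x⁻¹ *_) x*y≡0 ⟩
    x⁻¹ * 0#          ≡⟨ zeroʳ x⁻¹ ⟩
    0#                ∎

  x≢0∧y≢0⇒x*y≢0 : ∀ {x y} → x ≢ 0# → y ≢ 0# → x * y ≢ 0#
  x≢0∧y≢0⇒x*y≢0 x≢0 y≢0 x*y≡0 = y≢0 (x≢0∧x*y≡0⇒y≡0 x≢0 x*y≡0)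

  -x*-x≡x*x : ∀ x → - x * - x ≡ x * x
  -x*-x≡x*x x = begin
    - x * - x     ≡⟨ sym (-‿distribˡ-* x (- x)) ⟩
    - (x * - x)   ≡⟨ cong -_ (sym (-‿distribʳ-* x x)) ⟩
    - - (x * x)   ≡⟨ -‿involutive (x * x) ⟩
    x * x         ∎

  ∏≡0 : ∀ {m} (f : Fin m → Carrier) i → f i ≡ 0# → ∏ f ≡ 0#
  ∏≡0 f zero    fi≡0 = trans (cong (_* ∏ (f ∘ suc)) fi≡0) (zeroˡ _)
  ∏≡0 f (suc i) fi≡0 = trans (cong (f zero *_) (∏≡0 (f ∘ suc) i fi≡0)) (zeroʳ _)

  ∏≢0 : ∀ {m} (f : Fin m → Carrier) → (∀ i → f i ≢ 0#) → ∏ f ≢ 0#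
  ∏≢0 {zero}  f _    1≡0 = 0≢1 (sym 1≡0)
  ∏≢0 {suc m} f fi≢0 = x≢0∧y≢0⇒x*y≢0 (fi≢0 zero) (∏≢0 (f ∘ suc) (fi≢0 ∘ suc))

  infixr 7 _·_
  infixl 6 _⊕_

  _·_ : ∀ {n} → Carrier → Vec Carrier n → Vec Carrier n
  c · u = map (c *_) u

  _⊕_ : ∀ {n} → Vec Carrier n → Vec Carrier n → Vec Carrier n
  _⊕_ = zipWith _+_

  ⟨,⟩-comm : ∀ {n} (u v : Vec Carrier n) → ⟨ u , v ⟩ ≡ ⟨ v , u ⟩
  ⟨,⟩-comm []      []      = refl
  ⟨,⟩-comm (x ∷ u) (y ∷ v) = cong₂ _+_ (*-comm x y) (⟨,⟩-comm u v)

  ⟨++,++⟩ : ∀ {m n} (u x : Vec Carrier m) (v y : Vec Carrier n) →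
            ⟨ u ++ v , x ++ y ⟩ ≡ ⟨ u , x ⟩ + ⟨ v , y ⟩
  ⟨++,++⟩ []      []      v y = sym (+-identityˡ _)
  ⟨++,++⟩ (a ∷ u) (b ∷ x) v y = trans (cong (a * b +_) (⟨++,++⟩ u x v y)) (sym (+-assoc _ _ _))

  ⟨·,⟩ : ∀ {n} c (u z : Vec Carrier n) → ⟨ c · u , z ⟩ ≡ c * ⟨ u , z ⟩
  ⟨·,⟩ c []      []      = sym (zeroʳ c)
  ⟨·,⟩ c (x ∷ u) (y ∷ z) = begin
    c * x * y + ⟨ c · u , z ⟩   ≡⟨ cong₂ _+_ (*-assoc c x y) (⟨·,⟩ c u z) ⟩
    c * (x * y) + c * ⟨ u , z ⟩ ≡⟨ sym (distribˡ c _ _) ⟩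
    c * (x * y + ⟨ u , z ⟩)     ∎

  ⟨⊖,⟩ : ∀ {n} (u v z : Vec Carrier n) → ⟨ u ⊖ v , z ⟩ ≡ ⟨ u , z ⟩ - ⟨ v , z ⟩
  ⟨⊖,⟩ []      []      []      = sym (-‿inverseʳ 0#)
  ⟨⊖,⟩ (x ∷ u) (y ∷ v) (w ∷ z) = begin
    (x - y) * w + ⟨ u ⊖ v , z ⟩                   ≡⟨ cong₂ _+_ ([y-z]x≈yx-zx w x y) (⟨⊖,⟩ u v z) ⟩
    (x * w - y * w) + (⟨ u , z ⟩ - ⟨ v , z ⟩)     ≡⟨ interchange _ _ _ _ ⟩
    (x * w + ⟨ u , z ⟩) + (- (y * w) - ⟨ v , z ⟩) ≡⟨ cong ((x * w + ⟨ u , z ⟩) +_) (-‿+-comm _ _) ⟩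
    (x * w + ⟨ u , z ⟩) - (y * w + ⟨ v , z ⟩)     ∎

  _⊗_ : ∀ {m n} → Vec Carrier m → Vec Carrier n → Vec Carrier (m ℕ.* n)
  []      ⊗ v = []
  (a ∷ u) ⊗ v = a · v ++ u ⊗ v

  ⟨⊗,⊗⟩ : ∀ {m n} (u x : Vec Carrier m) (v y : Vec Carrier n) →
          ⟨ u ⊗ v , x ⊗ y ⟩ ≡ ⟨ u , x ⟩ * ⟨ v , y ⟩
  ⟨⊗,⊗⟩ []      []      v y = sym (zeroˡ _)
  ⟨⊗,⊗⟩ (a ∷ u) (b ∷ x) v y = begin
    ⟨ a · v ++ u ⊗ v , b · y ++ x ⊗ y ⟩      ≡⟨ ⟨++,++⟩ (a · v) (b · y) (u ⊗ v) (x ⊗ y) ⟩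
    ⟨ a · v , b · y ⟩ + ⟨ u ⊗ v , x ⊗ y ⟩   ≡⟨ cong₂ _+_ ⟨a·v,b·y⟩ (⟨⊗,⊗⟩ u x v y) ⟩
    a * b * ⟨ v , y ⟩ + ⟨ u , x ⟩ * ⟨ v , y ⟩ ≡⟨ sym (distribʳ _ _ _) ⟩
    (a * b + ⟨ u , x ⟩) * ⟨ v , y ⟩         ∎
    where
    ⟨a·v,b·y⟩ : ⟨ a · v , b · y ⟩ ≡ a * b * ⟨ v , y ⟩
    ⟨a·v,b·y⟩ = begin
      ⟨ a · v , b · y ⟩   ≡⟨ ⟨·,⟩ a v (b · y) ⟩
      a * ⟨ v , b · y ⟩   ≡⟨ cong (a *_) (trans (⟨,⟩-comm v (b · y)) (trans (⟨·,⟩ b y v) (cong (b *_) (⟨,⟩-comm y v)))) ⟩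
      a * (b * ⟨ v , y ⟩) ≡⟨ sym (*-assoc a b _) ⟩
      a * b * ⟨ v , y ⟩   ∎

  ⨂ : ∀ {m d} → (Fin m → Vec Carrier d) → Vec Carrier (d ℕ.^ m)
  ⨂ {zero}  _  = 1# ∷ []
  ⨂ {suc m} ws = ws zero ⊗ ⨂ (ws ∘ suc)

  ⟨⨂,⨂⟩ : ∀ {m d} (ws xs : Fin m → Vec Carrier d) → ⟨ ⨂ ws , ⨂ xs ⟩ ≡ ∏ (λ i → ⟨ ws i , xs i ⟩)
  ⟨⨂,⨂⟩ {zero}  _  _  = trans (+-identityʳ _) (*-identityˡ 1#)
  ⟨⨂,⨂⟩ {suc m} ws xs =
    trans (⟨⊗,⊗⟩ (ws zero) (xs zero) _ _) (cong (_ *_) (⟨⨂,⨂⟩ (ws ∘ suc) (xs ∘ suc)))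

  -- Biorthogonal systems

  record Biorthogonal {m d} (v φ : Fin m → Vec Carrier d) : Set where
    field
      off-diagonal : ∀ {i j} → i ≢ j → ⟨ v i , φ j ⟩ ≡ 0#
      diagonal     : ∀ i → ⟨ v i , φ i ⟩ ≢ 0#

  ⟨,⟩-head≡0 : ∀ {n} (u z : Vec Carrier (suc n)) → head u ≡ 0# → ⟨ u , z ⟩ ≡ ⟨ tail u , tail z ⟩
  ⟨,⟩-head≡0 (x ∷ u) (y ∷ z) x≡0 = begin
    x * y + ⟨ u , z ⟩    ≡⟨ cong (λ t → t * y + ⟨ u , z ⟩) x≡0 ⟩
    0# * y + ⟨ u , z ⟩   ≡⟨ cong (_+ ⟨ u , z ⟩) (zeroˡ y) ⟩
    0# + ⟨ u , z ⟩       ≡⟨ +-identityˡ _ ⟩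
    ⟨ u , z ⟩            ∎

  biorthogonal-tail : ∀ {m d} {v φ : Fin m → Vec Carrier (suc d)} → (∀ i → head (v i) ≡ 0#) →
                      Biorthogonal v φ → Biorthogonal (tail ∘ v) (tail ∘ φ)
  biorthogonal-tail {v = v} {φ} heads≡0 b = record
    { off-diagonal = λ {i} {j} i≢j → trans (sym (⟨,⟩-head≡0 (v i) (φ j) (heads≡0 i))) (off-diagonal i≢j)
    ; diagonal     = λ i → diagonal i ∘ trans (⟨,⟩-head≡0 (v i) (φ i) (heads≡0 i))
    }
    where open Biorthogonal b

  ⟨⊖·,⟩ : ∀ {n} c (u w z : Vec Carrier n) → ⟨ u ⊖ (c · w) , z ⟩ ≡ ⟨ u , z ⟩ - c * ⟨ w , z ⟩
  ⟨⊖·,⟩ c u w z = trans (⟨⊖,⟩ u (c · w) z) (cong (λ t → ⟨ u , z ⟩ - t) (⟨·,⟩ c w z))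

  head-cancelling : ∀ {n} (w : Vec Carrier (suc n)) → head w ≢ 0# → (u : Vec Carrier (suc n)) →
                    ∃ λ c → head (u ⊖ (c · w)) ≡ 0#
  head-cancelling (x ∷ w) x≢0 (y ∷ u) with inverse x x≢0
  ... | x⁻¹ , x*x⁻¹≡1 = y * x⁻¹ , (begin
    y - y * x⁻¹ * x     ≡⟨ cong (λ t → y - t) (*-assoc y x⁻¹ x) ⟩
    y - y * (x⁻¹ * x)   ≡⟨ cong (λ t → y - y * t) (trans (*-comm x⁻¹ x) x*x⁻¹≡1) ⟩
    y - y * 1#          ≡⟨ cong (λ t → y - t) (*-identityʳ y) ⟩
    y - y               ≡⟨ -‿inverseʳ y ⟩
    0#                  ∎)

  biorthogonal-eliminate : ∀ {m d} {v φ : Fin (suc m) → Vec Carrier (suc d)} i₀ →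
    head (v i₀) ≢ 0# → Biorthogonal v φ →
    ∃ λ (u : Fin m → Vec Carrier (suc d)) → (∀ i → head (u i) ≡ 0#) × Biorthogonal u (φ ∘ punchIn i₀)
  biorthogonal-eliminate {m} {d} {v} {φ} i₀ pivot≢0 b = u , proj₂ ∘ cancel , record
    { off-diagonal = λ {i} {j} i≢j → trans (⟨u,φ⟩ i j) (off-diagonal (i≢j ∘ punchIn-injective i₀ i j))
    ; diagonal     = λ i → diagonal (punchIn i₀ i) ∘ trans (sym (⟨u,φ⟩ i i))
    }
    where
    open Biorthogonal b
    cancel : ∀ i → ∃ λ c → head (v (punchIn i₀ i) ⊖ (c · v i₀)) ≡ 0#
    cancel i = head-cancelling (v i₀) pivot≢0 (v (punchIn i₀ i))
    u : Fin m → Vec Carrier (suc d)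
    u i = v (punchIn i₀ i) ⊖ (proj₁ (cancel i) · v i₀)
    ⟨u,φ⟩ : ∀ i j → ⟨ u i , φ (punchIn i₀ j) ⟩ ≡ ⟨ v (punchIn i₀ i) , φ (punchIn i₀ j) ⟩
    ⟨u,φ⟩ i j = begin
      ⟨ u i , φ j′ ⟩                         ≡⟨ ⟨⊖·,⟩ c (v i′) (v i₀) (φ j′) ⟩
      ⟨ v i′ , φ j′ ⟩ - c * ⟨ v i₀ , φ j′ ⟩   ≡⟨ cong (λ t → ⟨ v i′ , φ j′ ⟩ - c * t) (off-diagonal (punchInᵢ≢i i₀ j ∘ sym)) ⟩
      ⟨ v i′ , φ j′ ⟩ - c * 0#               ≡⟨ cong (λ t → ⟨ v i′ , φ j′ ⟩ - t) (zeroʳ c) ⟩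
      ⟨ v i′ , φ j′ ⟩ - 0#                   ≡⟨ cong (⟨ v i′ , φ j′ ⟩ +_) -0#≈0# ⟩
      ⟨ v i′ , φ j′ ⟩ + 0#                   ≡⟨ +-identityʳ _ ⟩
      ⟨ v i′ , φ j′ ⟩                        ∎
      where
      i′ j′ : Fin (suc m)
      i′ = punchIn i₀ i
      j′ = punchIn i₀ j
      c : Carrier
      c = proj₁ (cancel i)

  biorthogonal⇒≤ : ∀ {m d} {v φ : Fin m → Vec Carrier d} → Biorthogonal v φ → m ≤ d
  biorthogonal⇒≤ {zero}          _ = z≤n
  biorthogonal⇒≤ {suc m} {zero}  {v} {φ} b = ⊥-elim (Biorthogonal.diagonal b zero (⟨[],[]⟩ (v zero) (φ zero)))
    where
    ⟨[],[]⟩ : (u z : Vec Carrier 0) → ⟨ u , z ⟩ ≡ 0#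
    ⟨[],[]⟩ [] [] = refl
  biorthogonal⇒≤ {suc m} {suc d} {v} b with all? (λ i → head (v i) ≟ 0#)
  ... | yes heads≡0 = m≤n⇒m≤1+n (biorthogonal⇒≤ (biorthogonal-tail heads≡0 b))
  ... | no ¬heads≡0 with ¬∀⟶∃¬ _ _ (λ i → head (v i) ≟ 0#) ¬heads≡0
  ...   | i₀ , pivot≢0 with biorthogonal-eliminate i₀ pivot≢0 b
  ...     | _ , heads≡0 , b′ = s≤s (biorthogonal⇒≤ (biorthogonal-tail heads≡0 b′))

  -- Isotropy

  Q : ∀ {n} → Vec Carrier n → Carrier
  Q u = ⟨ u , u ⟩

  Q-⊕ : ∀ {n} (u v : Vec Carrier n) → Q (u ⊕ v) ≡ Q u + (1# + 1#) * ⟨ u , v ⟩ + Q v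
  Q-⊕ []      []      = sym (trans (+-identityʳ _) (trans (+-identityˡ _) (zeroʳ _)))
  Q-⊕ (x ∷ u) (y ∷ v) = begin
    (x + y) * (x + y) + Q (u ⊕ v)                             ≡⟨ cong ((x + y) * (x + y) +_) (Q-⊕ u v) ⟩
    (x + y) * (x + y) + (Q u + (1# + 1#) * ⟨ u , v ⟩ + Q v)  ≡⟨ expand x y (Q u) ⟨ u , v ⟩ (Q v) ⟩
    (x * x + Q u) + (1# + 1#) * (x * y + ⟨ u , v ⟩) + (y * y + Q v) ∎
    where
    expand : ∀ x y a b c → (x + y) * (x + y) + (a + (1# + 1#) * b + c) ≡
                           (x * x + a) + (1# + 1#) * (x * y + b) + (y * y + c)
    expand = solve 5 (λ x y a b c → (x :+ y) :* (x :+ y) :+ (a :+ con 2 :* b :+ c) :=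
                                    (x :* x :+ a) :+ con 2 :* (x :* y :+ b) :+ (y :* y :+ c)) refl

  ⊖-⊕-⊖ : ∀ {n} (a b c : Vec Carrier n) → (a ⊖ b) ⊕ (b ⊖ c) ≡ a ⊖ c
  ⊖-⊕-⊖ []      []      []      = refl
  ⊖-⊕-⊖ (x ∷ a) (y ∷ b) (z ∷ c) = cong₂ _∷_ (begin
    (x - y) + (y - z)   ≡⟨ +-assoc x (- y) (y - z) ⟩
    x + (- y + (y - z)) ≡⟨ cong (x +_) (sym (+-assoc (- y) y (- z))) ⟩
    x + ((- y + y) - z) ≡⟨ cong (λ t → x + (t - z)) (-‿inverseˡ y) ⟩
    x + (0# - z)        ≡⟨ cong (x +_) (+-identityˡ (- z)) ⟩
    x - z               ∎) (⊖-⊕-⊖ a b c)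

  Q-⊖-comm : ∀ {n} (a b : Vec Carrier n) → Q (a ⊖ b) ≡ Q (b ⊖ a)
  Q-⊖-comm []      []      = refl
  Q-⊖-comm (x ∷ a) (y ∷ b) = cong₂ _+_ (begin
    (x - y) * (x - y)         ≡⟨ cong (λ t → t * t) (sym (⁻¹-anti-homo‿- y x)) ⟩
    - (y - x) * - (y - x)     ≡⟨ -x*-x≡x*x (y - x) ⟩
    (y - x) * (y - x)         ∎) (Q-⊖-comm a b)

  Q-⊖-self : ∀ {n} (a : Vec Carrier n) → Q (a ⊖ a) ≡ 0#
  Q-⊖-self []      = refl
  Q-⊖-self (x ∷ a) = begin
    (x - x) * (x - x) + Q (a ⊖ a) ≡⟨ cong₂ (λ s t → s * s + t) (-‿inverseʳ x) (Q-⊖-self a) ⟩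
    0# * 0# + 0#                  ≡⟨ trans (+-identityʳ _) (zeroˡ 0#) ⟩
    0#                            ∎

  Isotropic : ∀ {n} → Vec Carrier n → Vec Carrier n → Set
  Isotropic a b = Q (a ⊖ b) ≡ 0#

  isotropic? : ∀ {n} (a b : Vec Carrier n) → Dec (Isotropic a b)
  isotropic? a b = Q (a ⊖ b) ≟ 0#

  isotropic-sym : ∀ {n} (a b : Vec Carrier n) → Isotropic a b → Isotropic b a
  isotropic-sym a b = trans (Q-⊖-comm b a)

  isotropic-triangle⇒⟨⊖,⊖⟩≡0 : ∀ {n} {a b c : Vec Carrier n} → 1# + 1# ≢ 0# →
    Isotropic a b → Isotropic b c → Isotropic a c → ⟨ a ⊖ b , b ⊖ c ⟩ ≡ 0#
  isotropic-triangle⇒⟨⊖,⊖⟩≡0 {a = a} {b} {c} 2≢0 ab bc ac = x≢0∧x*y≡0⇒y≡0 2≢0 (begin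
    2T                             ≡⟨ sym (trans (+-identityʳ _) (+-identityˡ _)) ⟩
    0# + 2T + 0#                   ≡⟨ cong₂ (λ s t → s + 2T + t) (sym ab) (sym bc) ⟩
    Q (a ⊖ b) + 2T + Q (b ⊖ c)     ≡⟨ sym (Q-⊕ (a ⊖ b) (b ⊖ c)) ⟩
    Q ((a ⊖ b) ⊕ (b ⊖ c))          ≡⟨ cong Q (⊖-⊕-⊖ a b c) ⟩
    Q (a ⊖ c)                      ≡⟨ ac ⟩
    0#                             ∎)
    where
    2T : Carrier
    2T = (1# + 1#) * ⟨ a ⊖ b , b ⊖ c ⟩

  AllRightAngles : ∀ {k n} → (Fin k → Vec Carrier n) → Set
  AllRightAngles x = ∀ i j l → i ≢ j → j ≢ l → i ≢ l → ⟨ x i ⊖ x j , x j ⊖ x l ⟩ ≡ 0#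

  RightAngledSubset : ∀ {n} → ℕ → List (Vec Carrier n) → Set
  RightAngledSubset {n} k A =
    Σ (Fin k → Vec Carrier n) λ x → Injective _≡_ _≡_ x × (∀ i → x i ∈ A) × AllRightAngles x

  -- The polynomial method

  record NonzeroEnumeration (m : ℕ) : Set where
    field
      element   : Fin m → Carrier
      element≢0 : ∀ i → element i ≢ 0#
      onto      : ∀ {c} → c ≢ 0# → ∃ λ i → element i ≡ c

  module _ {m} (nonzero : NonzeroEnumeration m) where

    open NonzeroEnumeration nonzero

    δ : Carrier → Carrier
    δ x = ∏ (λ i → x - element i)

    δ≡0 : ∀ {x} → x ≢ 0# → δ x ≡ 0#
    δ≡0 {x} x≢0 with onto x≢0
    ... | i , element≡x = ∏≡0 _ i (trans (cong (λ c → x - c) element≡x) (-‿inverseʳ x))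

    δ[0]≢0 : δ 0# ≢ 0#
    δ[0]≢0 = ∏≢0 _ λ i 0-c≡0 → element≢0 i (begin
      element i       ≡⟨ sym (-‿involutive _) ⟩
      - - element i   ≡⟨ cong -_ (trans (sym (+-identityˡ _)) 0-c≡0) ⟩
      - 0#            ≡⟨ -0#≈0# ⟩
      0#              ∎)

    neg : ∀ {n} → Vec Carrier n → Vec Carrier n
    neg = map (-_)

    ⊖≡⊕neg : ∀ {n} (a b : Vec Carrier n) → a ⊖ b ≡ a ⊕ neg b
    ⊖≡⊕neg []      []      = refl
    ⊖≡⊕neg (x ∷ a) (y ∷ b) = cong (x - y ∷_) (⊖≡⊕neg a b)

    Q-neg : ∀ {n} (b : Vec Carrier n) → Q (neg b) ≡ Q b
    Q-neg []      = refl
    Q-neg (y ∷ b) = cong₂ _+_ (-x*-x≡x*x y) (Q-neg b)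

    -- Q (a ⊖ b) − c = (Q a − c) · 1 + 1 · Q b + 2⟨a, −b⟩ is linear in (1, Q b, −b).
    lift : ∀ {n} → Vec Carrier n → Carrier → Vec Carrier (2 ℕ.+ n)
    lift a c = (Q a - c) ∷ 1# ∷ (1# + 1#) · a

    probe : ∀ {n} → Vec Carrier n → Vec Carrier (2 ℕ.+ n)
    probe b = 1# ∷ Q b ∷ neg b

    ⟨lift,probe⟩ : ∀ {n} (a : Vec Carrier n) c b → ⟨ lift a c , probe b ⟩ ≡ Q (a ⊖ b) - c
    ⟨lift,probe⟩ a c b = begin
      (Q a - c) * 1# + (1# * Q b + ⟨ (1# + 1#) · a , neg b ⟩)   ≡⟨ cong (λ t → (Q a - c) * 1# + (1# * Q b + t)) (⟨·,⟩ _ a (neg b)) ⟩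
      (Q a - c) * 1# + (1# * Q b + (1# + 1#) * ⟨ a , neg b ⟩)   ≡⟨ rearrange (Q a) (- c) (Q b) ⟨ a , neg b ⟩ ⟩
      Q a + (1# + 1#) * ⟨ a , neg b ⟩ + Q b - c                  ≡⟨ cong (λ t → Q a + (1# + 1#) * ⟨ a , neg b ⟩ + t - c) (sym (Q-neg b)) ⟩
      Q a + (1# + 1#) * ⟨ a , neg b ⟩ + Q (neg b) - c            ≡⟨ cong (_- c) (sym (Q-⊕ a (neg b))) ⟩
      Q (a ⊕ neg b) - c                                          ≡⟨ cong (λ t → Q t - c) (sym (⊖≡⊕neg a b)) ⟩
      Q (a ⊖ b) - c                                              ∎
      where
      rearrange : ∀ x y z w → (x + y) * 1# + (1# * z + (1# + 1#) * w) ≡ x + (1# + 1#) * w + z + y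
      rearrange = solve 4 (λ x y z w → (x :+ y) :* con 1 :+ (con 1 :* z :+ con 2 :* w) :=
                                       x :+ con 2 :* w :+ z :+ y) refl

    nonIsotropic-length≤ : ∀ {n} (X : List (Vec Carrier n)) → AllPairs (λ a b → ¬ Isotropic a b) X →
                           length X ≤ (2 ℕ.+ n) ℕ.^ m
    nonIsotropic-length≤ {n} X nonIsotropic = biorthogonal⇒≤ {v = v} {φ} (record
      { off-diagonal = λ i≢j → trans (⟨v,φ⟩ _ _)
          (δ≡0 (lookup-AllPairs (λ {a} {b} ¬ab → ¬ab ∘ isotropic-sym b a) nonIsotropic i≢j))
      ; diagonal     = λ i → δ[0]≢0 ∘ trans (cong δ (sym (Q-⊖-self (lookup X i)))) ∘ trans (sym (⟨v,φ⟩ i i))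
      })
      where
      v φ : Fin (length X) → Vec Carrier ((2 ℕ.+ n) ℕ.^ m)
      v i = ⨂ (lift (lookup X i) ∘ element)
      φ j = ⨂ (λ (_ : Fin m) → probe (lookup X j))
      ⟨v,φ⟩ : ∀ i j → ⟨ v i , φ j ⟩ ≡ δ (Q (lookup X i ⊖ lookup X j))
      ⟨v,φ⟩ i j = trans (⟨⨂,⨂⟩ (lift (lookup X i) ∘ element) (λ _ → probe (lookup X j)))
                        (sum-cong-≗ (λ k → ⟨lift,probe⟩ (lookup X i) (element k) (lookup X j)))

    rightAngleFree-length≤ : 1# + 1# ≢ 0# → ∀ k {n} (A : List (Vec Carrier n)) → Unique A →
                            ¬ RightAngledSubset k A → length A ≤ ramseyBound k (suc ((2 ℕ.+ n) ℕ.^ m))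
    rightAngleFree-length≤ 2≢0 k {n} A unique noRightAngled =
      ramsey isotropic? k _ A unique clique<k (λ _ nonIsotropic → s≤s (nonIsotropic-length≤ _ nonIsotropic))
      where
      clique<k : ∀ {X} → X ⊆ A → Unique X → AllPairs Isotropic X → length X ℕ.< k
      clique<k {X} X⊆A uniqueX isotropicX with k ≤? length X
      ... | no  k≰|X| = ≰⇒> k≰|X|
      ... | yes k≤|X| = ⊥-elim (noRightAngled (x , x-injective , (X⊆A ∘ ∈-lookup ∘ ι) , rightAngles))
        where
        ι : Fin k → Fin (length X)
        ι i = inject≤ i k≤|X|
        ι-≢ : ∀ {i j} → i ≢ j → ι i ≢ ι j
        ι-≢ {i} {j} i≢j = i≢j ∘ inject≤-injective k≤|X| k≤|X| i j
        x : Fin k → Vec Carrier n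
        x = lookup X ∘ ι
        x-injective : Injective _≡_ _≡_ x
        x-injective {i} {j} xi≡xj = decidable-stable (i Fin.≟ j)
          (λ i≢j → lookup-AllPairs (_∘ sym) uniqueX (ι-≢ i≢j) xi≡xj)
        isotropic : ∀ {i j} → i ≢ j → Isotropic (x i) (x j)
        isotropic = lookup-AllPairs (λ {a} {b} → isotropic-sym a b) isotropicX ∘ ι-≢
        rightAngles : AllRightAngles x
        rightAngles i j l i≢j j≢l i≢l =
          isotropic-triangle⇒⟨⊖,⊖⟩≡0 {a = x i} {x j} {x l} 2≢0 (isotropic i≢j) (isotropic j≢l) (isotropic i≢l)

nonzeroEnumeration : ∀ {q} (F : FiniteField (suc q)) → NonzeroEnumeration F q
nonzeroEnumeration {q} F = record
  { element   = from ∘ punchIn z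
  ; element≢0 = λ i fromᵢ≡0 → punchInᵢ≢i z i (trans (sym (strictlyInverseˡ (punchIn z i))) (cong to fromᵢ≡0))
  ; onto      = λ {c} c≢0 →
      let z≢c = c≢0 ∘ sym ∘ Injection.injective (↔⇒↣ card) in
      punchOut z≢c , trans (cong from (punchIn-punchOut z≢c)) (strictlyInverseʳ c)
  }
  where
  open FiniteField F using (0#; card)
  open Inverse card using (to; from; strictlyInverseˡ; strictlyInverseʳ)
  z : Fin (suc q)
  z = to 0#

open import Data.Nat using (_+_; _*_; _^_; _∸_)

rightAngleFree-polynomialBound : ∀ {q} (F : FiniteField q) → ¬ 2 ∣ q →
  ∀ k n → 1 ≤ n → (A : List (Vec (FiniteField.Carrier F) n)) → Unique A → ¬ RightAngledSubset F k A →
  length A ≤ (k + 1 + 3 ^ (q ∸ 1)) ^ k * n ^ ((k + 1) * (q ∸ 1))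
rightAngleFree-polynomialBound {zero} F with Inverse.to (FiniteField.card F) (FiniteField.0# F)
... | ()
rightAngleFree-polynomialBound {suc q} F 2∤q k n 1≤n A unique noRightAngled =
  ≤-trans (rightAngleFree-length≤ F (nonzeroEnumeration F) (2∤q ∘ 1+1≡0⇒2∣q F) k A unique noRightAngled)
          (ramseyBound-poly k q n 1≤n)

mainTheorem7 : (k p ℓ : ℕ) → 1 ≤ k → Prime p → k ≤ p → 1 ≤ ℓ → ¬ (p ≡ 2) →
    Σ ℕ λ C → (F : FiniteField (p ^ ℓ)) →
      (n : ℕ) → 1 ≤ n → (A : List (Vec (FiniteField.Carrier F) n)) → Unique A →
      ¬ (Σ (Fin k → Vec (FiniteField.Carrier F) n) λ x →
           Injective _≡_ _≡_ x × ((i : Fin k) → x i ∈ A) ×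
           ((i j l : Fin k) → i ≢ j → j ≢ l → i ≢ l →
              FiniteField.⟨_,_⟩ F (FiniteField._⊖_ F (x i) (x j)) (FiniteField._⊖_ F (x j) (x l)) ≡ FiniteField.0# F)) →
      length A ≤ C * n ^ ((k + 1) * (p ^ ℓ ∸ 1))
mainTheorem7 k p ℓ _ p-prime _ _ p≢2 =
  (k + 1 + 3 ^ (p ^ ℓ ∸ 1)) ^ k , λ F → rightAngleFree-polynomialBound F (odd-prime⇒2∤p^ℓ ℓ p-prime p≢2) k
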